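{- Let $r,s\in\mathbb{N}$ and let $\mathcal{S}$ be a signature consisting of exactly $s$ elements, all of arity $r+1$. Let $\mathcal{V}\subseteq\mathbf{N}(\mathfrak{T}(\mathcal{S}))$ be the linear span of the elements $\mathsf{E}_{[\mathfrak{f}]_{\equiv}}:=\sum_{\mathfrak{f}'\equiv\mathfrak{f}}\mathsf{E}_{\mathfrak{f}'}$, $\mathfrak{f}$ a reduced $\mathcal{S}$-forest, which is a Hopf subalgebra isomorphic to $\mathbf{N}(\mathsf{MAs}_{\mathcal{S}})$ via $\mathsf{E}_{[\mathfrak{f}]_{\equiv}}\mapsto\mathsf{E}_{[\mathfrak{f}_1]_\equiv\cdots[\mathfrak{f}_k]_\equiv}$. Then the space $\mathsf{r}_{\mathbb{A}_{\mathcal{S},\mathbb{N}}}(\mathcal{V})$, with the product of polynomials and the Hopf algebra structure induced through $\mathsf{r}_{\mathbb{A}_{\mathcal{S},\mathbb{N}}}$, is isomorphic to $\mathbf{N}(\mathsf{MAs}_{\mathcal{S}})$ (the Hopf algebra denoted $\mathbf{FdB}_{r,s}$).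
   Context: A signature is a graded set $\mathcal{S}=\bigsqcup_{n\ge0}\mathcal{S}(n)$. The free operad $\mathfrak{T}(\mathcal{S})$ consists of $\mathcal{S}$-terms (planar rooted trees with internal nodes decorated by $\mathcal{S}$, a node decorated by $\mathsf{g}\in\mathcal{S}(n)$ having $n$ ordered children; the single leaf $\perp$ is the unit), composition $\mathfrak{t}[\mathfrak{u}_1,\dots,\mathfrak{u}_n]$ grafting $\mathfrak{u}_i$ onto the $i$-th leaf, partial composition $\circ_i$, degree = number of internal nodes. $\mathsf{MAs}_{\mathcal{S}}:=\mathfrak{T}(\mathcal{S})/_{\equiv}$ where $\equiv$ is the operad congruence generated by $\mathsf{g}\circ_i\mathsf{g}'\equiv\mathsf{g}'\circ_{i'}\mathsf{g}$ for all $\mathsf{g},\mathsf{g}'\in\mathcal{S}$ and all $i\in[\mathrm{ar}(\mathsf{g})]$, $i'\in[\mathrm{ar}(\mathsf{g}')]$. For a finitely factorizable operad $\mathcal{O}$ with a grading (degree map vanishing exactly on the unit and additive under composition), the natural Hopf algebra $\mathbf{N}(\mathcal{O})$ over a field $\mathbb{K}$ of characteristic $0$ has basis $\mathsf{E}_w$ over words $w$ on $\mathcal{O}$ with no letter equal to the unit, product concatenation, and coproduct the algebra morphism with $\Delta\mathsf{E}_x=\sum[x=y[w_1,\dots,w_{\mathrm{ar}(y)}]]\,\mathsf{E}_{\mathrm{rd}(y)}\otimes\mathsf{E}_{\mathrm{rd}(w)}$ over $y\in\mathcal{O}$, $w\in\mathcal{O}^{\mathrm{ar}(y)}$, where $\mathrm{rd}$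 deletes letters equal to the unit. Reduced $\mathcal{S}$-forests are words of terms none equal to $\perp$; $\equiv$ is extended to them termwise (same length, termwise equivalent); internal nodes are numbered in left-to-right preorder. Let $\mathbb{A}_{\mathcal{S},\mathbb{N}}:=\{\mathbf{a}_{\mathsf{g},i}:\mathsf{g}\in\mathcal{S},i\in\mathbb{N}\}$, and for a reduced forest $\mathfrak{f}$ with $m$ internal nodes let $\mathsf{r}_{\mathbb{A}_{\mathcal{S},\mathbb{N}}}(\mathsf{E}_{\mathfrak{f}})$ be the sum (noncommutative polynomial of degree $m$, possibly infinite support) of all words $\mathbf{a}_{\mathsf{g}_1,i_1}\cdots\mathbf{a}_{\mathsf{g}_m,i_m}$ such that node $k$ is decorated by $\mathsf{g}_k$ for every $k$, and $i_k<i_{k'}$ whenever node $k'$ is a child of node $k$; extended linearly. -}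

module Defs where

open import Level using (Level; _⊔_)
open import Data.Nat using (ℕ; zero; suc; _≤_)
import Data.Nat as ℕ
open import Data.Fin using (Fin)
open import Data.Product using (Σ; _×_; _,_; proj₁)
open import Data.Vec as Vec using (Vec; []; _∷_; _[_]≔_; replicate)
open import Data.List as List using (List; []; _∷_; _++_; length)
open import Data.List.Relation.Unary.All using (All)
open import Data.List.Relation.Unary.Unique.Propositional using (Unique)
open import Data.List.Membership.Propositional using (_∈_)
import Data.Vec.Relation.Binary.Pointwise.Inductive as VPW
import Data.List.Relation.Binary.Pointwise as LPW
open import Relation.Binary.PropositionalEquality using (_≡_)
open import Relation.Nullary using (¬_)
open import Function.Bundles using (_⇔_)
open import Algebra.Bundles using (CommutativeRing)

module _ {c ℓ : Level} (K : CommutativeRing c ℓ) where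
  open CommutativeRing K

  fromℕ : ℕ → Carrier
  fromℕ zero    = 0#
  fromℕ (suc n) = 1# + fromℕ n

  record IsFieldChar0 : Set (c ⊔ ℓ) where
    field
      0≉1      : ¬ (0# ≈ 1#)
      inverse  : ∀ x → ¬ (x ≈ 0#) → Σ Carrier (λ y → x * y ≈ 1#)
      char0    : ∀ n → ¬ (fromℕ (suc n) ≈ 0#)

Count : {a p : Level} {A : Set a} → (A → Set p) → ℕ → Set (a ⊔ p)
Count {A = A} P n =
  Σ (List A) (λ L → Unique L × (∀ x → (x ∈ L) ⇔ P x) × length L ≡ n)

module Sig (r s : ℕ) where

  -- S-terms: planar rooted trees; ⊥t is the leaf (unit of the operad)
  data Term : Set where
    ⊥t   : Term
    node : Fin s → Vec Term (suc r) → Term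

  corolla : Fin s → Term
  corolla g = node g (replicate (suc r) ⊥t)

  _∘⟨_⟩_ : Fin s → Fin (suc r) → Fin s → Term
  g ∘⟨ i ⟩ g' = node g (replicate (suc r) ⊥t [ i ]≔ corolla g')

  -- full composition  t [ w₁ , … , w_k ] : graft the w's on the leaves
  -- of t, from left to right (returns the unused w's)
  mutual
    fill : Term → List Term → Term × List Term
    fill ⊥t []       = ⊥t , []
    fill ⊥t (w ∷ ws) = w , ws
    fill (node g cs) ws with fillV cs ws
    ... | cs' , ws' = node g cs' , ws'

    fillV : ∀ {n} → Vec Term n → List Term → Vec Term n × List Term
    fillV []       ws = [] , ws
    fillV (c ∷ cs) ws with fill c ws
    ... | c' , ws' with fillV cs ws'
    ... | cs' , ws'' = c' ∷ cs' , ws''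

  _[_] : Term → List Term → Term
  t [ ws ] = proj₁ (fill t ws)

  -- the operad congruence ≡ generated by  g ∘_i g' ≡ g' ∘_i' g :
  -- the smallest equivalence relation containing all the instances
  -- (g ∘_i g')[w₁,…,w_{2r+1}] ≡ (g' ∘_i' g)[w₁,…,w_{2r+1}]
  -- and compatible with the operad composition (closure under contexts).
  infix 4 _≡ₜ_
  data _≡ₜ_ : Term → Term → Set where
    gen    : ∀ g g' (i i' : Fin (suc r)) (ws : Vec Term (r ℕ.+ suc r)) →
             (g ∘⟨ i ⟩ g') [ Vec.toList ws ] ≡ₜ (g' ∘⟨ i' ⟩ g) [ Vec.toList ws ]
    node≡ₜ  : ∀ g {cs cs'} → VPW.Pointwise _≡ₜ_ cs cs' → node g cs ≡ₜ node g cs'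
    ≡ₜrefl  : ∀ {t} → t ≡ₜ t
    ≡ₜsym   : ∀ {t u} → t ≡ₜ u → u ≡ₜ t
    ≡ₜtrans : ∀ {t u v} → t ≡ₜ u → u ≡ₜ v → t ≡ₜ v

  Forest : Set
  Forest = List Term

  IsNode : Term → Set
  IsNode ⊥t         = Data.Empty.⊥ where import Data.Empty
  IsNode (node _ _) = Data.Unit.⊤ where import Data.Unit

  Reduced : Forest → Set
  Reduced = All IsNode

  infix 4 _≡F_
  _≡F_ : Forest → Forest → Set
  _≡F_ = LPW.Pointwise _≡ₜ_

  -- Alphabet A_{S,ℕ} = { a_{g,i} }, letters are pairs (g , i).
  Letter : Set
  Letter = Fin s × ℕ

  Word : Set
  Word = List Letter

  -- `AdmT b t u` : u is a word a_{g₁,i₁}⋯a_{g_m,i_m} where g_k is the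
  -- decoration of the k-th internal node of t in preorder, every index
  -- is ≥ b, and i_k < i_k' whenever node k' is a child of node k.
  mutual
    data AdmT (b : ℕ) : Term → Word → Set where
      leaf : AdmT b ⊥t []
      node : ∀ {g i cs u} → b ≤ i → AdmV (suc i) cs u →
             AdmT b (node g cs) ((g , i) ∷ u)

    data AdmV (b : ℕ) : ∀ {n} → Vec Term n → Word → Set where
      []  : AdmV b [] []
      _∷_ : ∀ {n c u₁ u₂} {cs : Vec Term n} →
            AdmT b c u₁ → AdmV b cs u₂ → AdmV b (c ∷ cs) (u₁ ++ u₂)

  -- words of r_A(E_f) for a forest f (preorder numbering across the
  -- whole forest, constraints only along parent/child edges)
  data AdmF : Forest → Word → Set where
    []  : AdmF [] []
    _∷_ : ∀ {t f u₁ u₂} → AdmT 0 t u₁ → AdmF f u₂ → AdmF (t ∷ f) (u₁ ++ u₂)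

  -- n = coefficient of the word u in r_A(E_{[f]≡}) = Σ_{f'≡f} r_A(E_{f'})
  ClassCoeff : Forest → Word → ℕ → Set
  ClassCoeff f u n = Count (λ f' → f' ≡F f × AdmF f' u) n

  -- Elements of N(MAs_S) over K: finite formal linear combinations
  -- Σ c_j E_{[f_j]≡}, given by a list of (coefficient, representative
  -- reduced forest); E_{[f]} is the basis element of the word of classes
  -- [f₁]≡ ⋯ [f_k]≡.

  module Lin {c ℓ : Level} (K : CommutativeRing c ℓ) where
    open CommutativeRing K

    Combo : Set c
    Combo = List (Carrier × Forest)

    ReducedCombo : Combo → Set c
    ReducedCombo x = All (λ e → Reduced (Data.Product.proj₂ e)) x
      where import Data.Product

    -- `SumClass x f k` : k is the total coefficient, in x, of the basis
    -- element E_{[f]≡} (sum of c_j over the j with f_j ≡ f).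
    data SumClass (f : Forest) : Combo → Carrier → Set (c ⊔ ℓ) where
      []   : SumClass f [] 0#
      yes∷ : ∀ {a g x k} → g ≡F f → SumClass f x k →
             SumClass f ((a , g) ∷ x) (a + k)
      no∷  : ∀ {a g x k} → ¬ (g ≡F f) → SumClass f x k →
             SumClass f ((a , g) ∷ x) k

    IsZeroN : Combo → Set (c ⊔ ℓ)
    IsZeroN x = ∀ f → Reduced f → ∀ k → SumClass f x k → k ≈ 0#

    -- `CoeffΦ x u k` : k is the coefficient of the word u in the
    -- (possibly infinite-support) noncommutative series
    -- Φ(x) = Σ_j c_j r_A(E_{[f_j]≡}).
    data CoeffΦ (u : Word) : Combo → Carrier → Set (c ⊔ ℓ) where
      []  : CoeffΦ u [] 0#
      _∷_ : ∀ {a f x n k} → ClassCoeff f u n → CoeffΦ u x k →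
            CoeffΦ u ((a , f) ∷ x) (a * fromℕ K n + k)

    IsZeroΦ : Combo → Set (c ⊔ ℓ)
    IsZeroΦ x = ∀ u k → CoeffΦ u x k → k ≈ 0#

  -- Product of series on basis images: the coefficient of u in
  -- r_A(E_{[f]}) · r_A(E_{[g]}) is Σ_{u = u₁u₂} coef_f(u₁) coef_g(u₂).

  splits : Word → List (Word × Word)
  splits []       = ([] , []) ∷ []
  splits (a ∷ u)  = ([] , a ∷ u) ∷ List.map (λ p → (a ∷ proj₁ p , Data.Product.proj₂ p)) (splits u)
    where import Data.Product

  data SplitSum (f g : Forest) : List (Word × Word) → ℕ → Set where
    []  : SplitSum f g [] 0
    _∷_ : ∀ {u₁ u₂ ps n₁ n₂ m} → ClassCoeff f u₁ n₁ → ClassCoeff g u₂ n₂ →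
          SplitSum f g ps m → SplitSum f g ((u₁ , u₂) ∷ ps) (n₁ ℕ.* n₂ ℕ.+ m)

-- Two terms are equivalent exactly when their multisets of decorations agree: a generating
-- relation only exchanges two decorations, and conversely rotating generating relations bring
-- every term to the left comb ("chain") of its decorations, which may then be permuted freely.
-- Hence equivalence is decidable and every coefficient of r_A(E_[f]) is a finite count.
--
-- The product formula holds because a word admitted by f ++ g splits, necessarily after as many
-- letters as f has nodes, into words admitted by f and by g.
--
-- For injectivity, the canonical word of f (indices increasing in preorder inside a tree,
-- dropping from one tree to the next) is admitted by no forest with at most as many trees as f
-- outside the class of f. So, by downward induction on the number of trees, the coefficient of
-- the canonical word in Φ(x) is a nonzero integer multiple of the class sum of f, and all class
-- sums of x vanish when Φ(x) does.

module Submission where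

open import Defs
open import Level using (Level; _⊔_)
open import Algebra.Bundles using (CommutativeRing)
open import Function.Base using (_∘_)
open import Function.Bundles using (_⇔_; mk⇔; Equivalence)
import Function.Properties.Equivalence
open import Data.Empty using (⊥-elim)
open import Data.Nat as ℕ using (ℕ; zero; suc; _+_; _*_; _≤_; _<_; z≤n; s≤s)
import Data.Nat.Properties as ℕP
open import Data.Fin as Fin using (Fin; toℕ)
import Data.Fin.Properties as FinP
open import Data.Product using (∃; ∃₂; _×_; _,_; proj₁; proj₂)
open import Data.Sum using (_⊎_; inj₁; inj₂)
open import Data.Vec as Vec using (Vec; []; _∷_; _[_]≔_; replicate)
import Data.Vec.Properties as VecP
import Data.Vec.Relation.Binary.Pointwise.Inductive as VPW
open import Data.List as List using (List; []; _∷_; _++_; length; drop; concat; filter; deduplicate; cartesianProductWith)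
import Data.List.Properties as LP
open import Data.List.Membership.Propositional using (_∈_)
open import Data.List.Membership.Propositional.Properties
  using ( ∈-∃++; ∈-allFin; ∈-filter⁺; ∈-filter⁻; ∈-deduplicate⁺; ∈-map⁻
        ; ∈-cartesianProductWith⁺; ∈-cartesianProductWith⁻)
open import Data.List.Membership.Propositional.Properties.WithK using (unique∧set⇒bag)
import Data.List.Membership.DecPropositional as DecMembership
open import Data.List.Relation.Unary.Any using (here; there)
open import Data.List.Relation.Unary.All as All using (All; []; _∷_)
import Data.List.Relation.Unary.All.Properties as AllP
open import Data.List.Relation.Unary.AllPairs using ([]; _∷_)
open import Data.List.Relation.Unary.Unique.Propositional using (Unique)
import Data.List.Relation.Unary.Unique.Propositional.Properties as Unique
import Data.List.Relation.Unary.Unique.DecPropositional.Properties as UniqueDec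
import Data.List.Relation.Binary.Pointwise as LPW
import Data.List.Relation.Binary.Pointwise.Properties as LPWP
open import Data.List.Relation.Binary.BagAndSetEquality using (∼bag⇒↭)
open import Data.List.Relation.Binary.Permutation.Propositional
  using (_↭_; prep; swap; ↭-refl; ↭-sym; ↭-trans; ↭-reflexive; module PermutationReasoning)
open import Data.List.Relation.Binary.Permutation.Propositional.Properties
  using (++⁺ˡ; ++⁺; ++-comm; shifts; shift; drop-∷; ↭-length; ↭-empty-inv; ¬x∷xs↭[]; ∈-resp-↭)
open import Relation.Binary.Definitions using (DecidableEquality)
open import Relation.Binary.PropositionalEquality
  using (_≡_; _≢_; refl; cong; cong₂; sym; trans; subst; subst₂; module ≡-Reasoning)
open import Relation.Nullary using (Dec; yes; no; ¬_; ¬?)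
open import Relation.Nullary.Decidable using (map′; _×-dec_)
open import Relation.Unary using (Decidable)

module _ {a b c : Level} {A : Set a} {B : Set b} {C : Set c} where

  length-cartesianProductWith : (f : A → B → C) (xs : List A) (ys : List B) →
                                length (cartesianProductWith f xs ys) ≡ length xs * length ys
  length-cartesianProductWith f []       ys = refl
  length-cartesianProductWith f (x ∷ xs) ys = begin
    length (List.map (f x) ys ++ cartesianProductWith f xs ys)  ≡⟨ LP.length-++ (List.map (f x) ys) ⟩
    length (List.map (f x) ys) + length (cartesianProductWith f xs ys)
      ≡⟨ cong₂ _+_ (LP.length-map (f x) ys) (length-cartesianProductWith f xs ys) ⟩
    length ys + length xs * length ys  ∎
    where open ≡-Reasoning

module _ {a : Level} {A : Set a} where

  ++-injective : ∀ (y y′ : List A) {z z′} → length y ≡ length y′ → y ++ z ≡ y′ ++ z′ → y ≡ y′ × z ≡ z′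
  ++-injective []      []        _   eq = refl , eq
  ++-injective (a ∷ y) (a′ ∷ y′) len eq with refl ← LP.∷-injectiveˡ eq
    with y≡y′ , z≡z′ ← ++-injective y y′ (ℕP.suc-injective len) (LP.∷-injectiveʳ eq) = cong (a ∷_) y≡y′ , z≡z′

  Unique-cartesianProduct++ : ∀ {ℓ} {xs ys : List (List A)} → (∀ {y} → y ∈ xs → length y ≡ ℓ) →
                              Unique xs → Unique ys → Unique (cartesianProductWith _++_ xs ys)
  Unique-cartesianProduct++ {xs = []}     len _          ys! = []
  Unique-cartesianProduct++ {xs = y ∷ xs} {ys} len (y∉xs ∷ xs!) ys! =
    Unique.++⁺ (Unique.map⁺ (LP.++-cancelˡ y _ _) ys!)
               (Unique-cartesianProduct++ (len ∘ there) xs! ys!) disjoint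
    where
      disjoint : ∀ {v} → ¬ (v ∈ List.map (y ++_) ys × v ∈ cartesianProductWith _++_ xs ys)
      disjoint (v∈y++ys , v∈xs++ys)
        with z , _ , refl ← ∈-map⁻ (y ++_) v∈y++ys
        with y′ , z′ , y′∈xs , _ , eq ← ∈-cartesianProductWith⁻ _++_ xs ys v∈xs++ys =
        All.lookup y∉xs y′∈xs (proj₁ (++-injective y y′ (trans (len (here refl)) (sym (len (there y′∈xs)))) eq))

prefixed : ∀ {a b} {A : Set a} {B : Set b} → List A → List (List A × B) → List (List A × B)
prefixed pre = List.map (λ p → pre ++ proj₁ p , proj₂ p)

prefixed-∷ : ∀ {a b} {A : Set a} {B : Set b} (pre : List A) x (ps : List (List A × B)) →
             prefixed pre (List.map (λ p → x ∷ proj₁ p , proj₂ p) ps) ≡ prefixed (pre ++ x ∷ []) ps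
prefixed-∷ pre x []       = refl
prefixed-∷ pre x (p ∷ ps) =
  cong₂ _∷_ (cong (_, proj₂ p) (sym (LP.++-assoc pre (x ∷ []) (proj₁ p)))) (prefixed-∷ pre x ps)

prefixed-∷-longer : ∀ {a b} {A : Set a} {B : Set b} {n} (pre : List A) x (ps : List (List A × B)) → length pre ≡ n →
                    All (λ p → length (proj₁ p) ≢ n) (prefixed pre (List.map (λ p → x ∷ proj₁ p , proj₂ p) ps))
prefixed-∷-longer pre x []       _   = []
prefixed-∷-longer pre x (p ∷ ps) len =
  (λ len′ → ℕP.<⇒≢ longer (trans len (sym len′))) ∷ prefixed-∷-longer pre x ps len
  where
    longer : length pre < length (pre ++ x ∷ proj₁ p)
    longer = subst (length pre <_) (sym (LP.length-++ pre)) (ℕP.m<m+n (length pre) (s≤s z≤n))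

length-++-≤ : ∀ {a} {A : Set a} (xs ys : List A) {n} → length (xs ++ ys) ≤ n → length xs ≤ n × length ys ≤ n
length-++-≤ xs ys le = ℕP.m+n≤o⇒m≤o _ le′ , ℕP.m+n≤o⇒n≤o _ le′
  where le′ = ℕP.≤-trans (ℕP.≤-reflexive (sym (LP.length-++ xs))) le

Pointwise-++⁻ : ∀ {a b ℓ} {A : Set a} {B : Set b} {R : A → B → Set ℓ} (ys : List B) {zs xs} →
                LPW.Pointwise R xs (ys ++ zs) →
                ∃₂ λ xs₁ xs₂ → xs ≡ xs₁ ++ xs₂ × LPW.Pointwise R xs₁ ys × LPW.Pointwise R xs₂ zs
Pointwise-++⁻ []       rs             = [] , _ , refl , LPW.[] , rs
Pointwise-++⁻ (y ∷ ys) (r′ LPW.∷ rs) with xs₁ , xs₂ , refl , rs₁ , rs₂ ← Pointwise-++⁻ ys rs =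
  _ ∷ xs₁ , xs₂ , refl , r′ LPW.∷ rs₁ , rs₂

++-split? : ∀ {a p q} {A : Set a} {P : List A → Set p} {Q : List A → Set q} →
            Decidable P → Decidable Q → ∀ w → Dec (∃₂ λ u₁ u₂ → w ≡ u₁ ++ u₂ × P u₁ × Q u₂)
++-split? P? Q? [] with P? [] ×-dec Q? []
... | yes (p , q) = yes ([] , [] , refl , p , q)
... | no ¬pq      = no λ { ([] , [] , refl , p , q) → ¬pq (p , q) }
++-split? {P = P} P? Q? (a ∷ w) with P? [] ×-dec Q? (a ∷ w) | ++-split? (P? ∘ (a ∷_)) Q? w
... | yes (p , q) | _                       = yes ([] , a ∷ w , refl , p , q)
... | no _        | yes (u₁ , u₂ , refl , p , q) = yes (a ∷ u₁ , u₂ , refl , p , q)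
... | no ¬here    | no ¬there = no λ
  { ([] , _ , refl , p , q)       → ¬here (p , q)
  ; (_ ∷ u₁ , u₂ , refl , p , q) → ¬there (u₁ , u₂ , refl , p , q) }

data LastNonEmpty {a} {A : Set a} : List (List A) → Set a where
  allEmpty : ∀ k → LastNonEmpty (List.replicate k [])
  lastAt   : ∀ ps h m k → LastNonEmpty (ps ++ (h ∷ m) ∷ List.replicate k [])

lastNonEmpty : ∀ {a} {A : Set a} (ls : List (List A)) → LastNonEmpty ls
lastNonEmpty []       = allEmpty 0
lastNonEmpty (l ∷ ls) with lastNonEmpty ls
lastNonEmpty ([]      ∷ _) | allEmpty k       = allEmpty (suc k)
lastNonEmpty ((h ∷ m) ∷ _) | allEmpty k       = lastAt [] h m k
lastNonEmpty (l       ∷ _) | lastAt ps h m k  = lastAt (l ∷ ps) h m k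

concat-replicate-[] : ∀ {a} {A : Set a} k → List.concat (List.replicate k ([] {A = A})) ≡ []
concat-replicate-[] zero    = refl
concat-replicate-[] (suc k) = concat-replicate-[] k

concat-lastAt : ∀ {a} {A : Set a} (ps : List (List A)) x k →
                List.concat (ps ++ x ∷ List.replicate k []) ≡ List.concat ps ++ x
concat-lastAt ps x k = begin
  List.concat (ps ++ x ∷ List.replicate k [])               ≡⟨ LP.concat-++ ps _ ⟨
  List.concat ps ++ x ++ List.concat (List.replicate k [])  ≡⟨ cong (λ z → List.concat ps ++ x ++ z) (concat-replicate-[] k) ⟩
  List.concat ps ++ x ++ []                                 ≡⟨ cong (List.concat ps ++_) (LP.++-identityʳ x) ⟩
  List.concat ps ++ x                                       ∎
  where open ≡-Reasoning

↭-dec : ∀ {a} {A : Set a} → DecidableEquality A → (xs ys : List A) → Dec (xs ↭ ys)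
↭-dec _≟_ []       []       = yes ↭-refl
↭-dec _≟_ []       (y ∷ ys) = no λ p → ¬x∷xs↭[] (↭-sym p)
↭-dec _≟_ (x ∷ xs) ys with DecMembership._∈?_ _≟_ x ys
... | no x∉ys = no λ p → x∉ys (∈-resp-↭ p (here refl))
... | yes x∈ys with ys₁ , ys₂ , refl ← ∈-∃++ x∈ys with ↭-dec _≟_ xs (ys₁ ++ ys₂)
...   | yes p = yes (↭-trans (prep x p) (↭-sym (shift x ys₁ ys₂)))
...   | no ¬p = no λ p → ¬p (drop-∷ (↭-trans p (shift x ys₁ ys₂)))

↭-cancelʳ : ∀ {a} {A : Set a} (xs : List A) {ys zs} → ys ++ xs ↭ zs ++ xs → ys ↭ zs
↭-cancelʳ xs {ys} {zs} p = cancelˡ xs (↭-trans (++-comm xs ys) (↭-trans p (++-comm zs xs)))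
  where
    cancelˡ : ∀ xs {ys zs} → xs ++ ys ↭ xs ++ zs → ys ↭ zs
    cancelˡ []       p = p
    cancelˡ (x ∷ xs) p = cancelˡ xs (drop-∷ p)

open Equivalence using (to; from)

module _ {a p q : Level} {A : Set a} {P : A → Set p} {Q : A → Set q} where

  Count-resp : (∀ x → P x ⇔ Q x) → ∀ {n} → Count P n → Count Q n
  Count-resp P⇔Q (L , L! , L⇔P , len) =
    L , L! , (λ x → mk⇔ (to (P⇔Q x) ∘ to (L⇔P x)) (from (L⇔P x) ∘ from (P⇔Q x))) , len

module _ {a p : Level} {A : Set a} {P : A → Set p} where

  Count-functional : ∀ {m n} → Count P m → Count P n → m ≡ n
  Count-functional (L , L! , L⇔P , refl) (M , M! , M⇔P , refl) =
    ↭-length (∼bag⇒↭ (unique∧set⇒bag L! M! (mk⇔ (from (M⇔P _) ∘ to (L⇔P _)) (from (L⇔P _) ∘ to (M⇔P _)))))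

  Count-empty : (∀ x → ¬ P x) → ∀ {n} → Count P n → n ≡ 0
  Count-empty ¬P ([]    , _ , _   , refl) = refl
  Count-empty ¬P (x ∷ L , _ , L⇔P , refl) = ⊥-elim (¬P x (to (L⇔P x) (here refl)))

  Count-inhabited : ∀ {x} → P x → ∀ {n} → Count P n → ∃ λ k → n ≡ suc k
  Count-inhabited {x} Px ([] , _ , L⇔P , refl) with () ← from (L⇔P x) Px
  Count-inhabited Px (y ∷ L , _ , _ , refl) = length L , refl

  Count-exhaustive : DecidableEquality A → Decidable P →
                     (L : List A) → (∀ {x} → P x → x ∈ L) → ∃ (Count P)
  Count-exhaustive _≟_ P? L complete =
    length M , M , Unique.filter⁺ P? (UniqueDec.deduplicate-! _≟_ L) , M⇔P , refl
    where
      M = filter P? (deduplicate _≟_ L)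
      M⇔P : ∀ x → x ∈ M ⇔ P x
      M⇔P x = mk⇔ (proj₂ ∘ ∈-filter⁻ P? {xs = deduplicate _≟_ L})
                  (λ Px → ∈-filter⁺ P? (∈-deduplicate⁺ _≟_ (complete Px)) Px)

module _ {a : Level} {A : Set a} where

  Count-++ : ∀ {p q} {P : List A → Set p} {Q : List A → Set q} {ℓ m n} →
             (∀ {y} → P y → length y ≡ ℓ) → Count P m → Count Q n →
             Count (λ v → ∃₂ λ y z → P y × Q z × v ≡ y ++ z) (m * n)
  Count-++ lenP (L , L! , L⇔P , refl) (M , M! , M⇔Q , refl) =
    cartesianProductWith _++_ L M ,
    Unique-cartesianProduct++ (lenP ∘ to (L⇔P _)) L! M! ,
    (λ v → mk⇔ split (λ { (y , z , Py , Qz , refl) → ∈-cartesianProductWith⁺ _++_ (from (L⇔P y) Py) (from (M⇔Q z) Qz) })) ,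
    length-cartesianProductWith _++_ L M
    where
      split : ∀ {v} → v ∈ cartesianProductWith _++_ L M → ∃₂ λ y z → _ × _ × v ≡ y ++ z
      split v∈ with y , z , y∈ , z∈ , refl ← ∈-cartesianProductWith⁻ _++_ L M v∈ =
        y , z , to (L⇔P y) y∈ , to (M⇔Q z) z∈ , refl

module Forests (r s : ℕ) where
  open Sig r s

  -- Equivalence of terms

  mutual
    labels : Term → List (Fin s)
    labels ⊥t          = []
    labels (node g cs) = g ∷ labelsᵛ cs

    labelsᵛ : ∀ {n} → Vec Term n → List (Fin s)
    labelsᵛ []       = []
    labelsᵛ (c ∷ cs) = labels c ++ labelsᵛ cs

  labelsᶠ : Forest → List (Fin s)
  labelsᶠ []      = []
  labelsᶠ (t ∷ f) = labels t ++ labelsᶠ f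

  mutual
    leaves : Term → ℕ
    leaves ⊥t          = 1
    leaves (node g cs) = leavesᵛ cs

    leavesᵛ : ∀ {n} → Vec Term n → ℕ
    leavesᵛ []       = 0
    leavesᵛ (c ∷ cs) = leaves c + leavesᵛ cs

  mutual
    fill-remainder : ∀ t ws → proj₂ (fill t ws) ≡ drop (leaves t) ws
    fill-remainder ⊥t          []       = refl
    fill-remainder ⊥t          (w ∷ ws) = refl
    fill-remainder (node g cs) ws       = fillV-remainder cs ws

    fillV-remainder : ∀ {n} (cs : Vec Term n) ws → proj₂ (fillV cs ws) ≡ drop (leavesᵛ cs) ws
    fillV-remainder []       ws = refl
    fillV-remainder (c ∷ cs) ws = begin
      proj₂ (fillV cs (proj₂ (fill c ws)))      ≡⟨ fillV-remainder cs _ ⟩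
      drop (leavesᵛ cs) (proj₂ (fill c ws))     ≡⟨ cong (drop (leavesᵛ cs)) (fill-remainder c ws) ⟩
      drop (leavesᵛ cs) (drop (leaves c) ws)    ≡⟨ LP.drop-drop (leaves c) (leavesᵛ cs) ws ⟩
      drop (leaves c + leavesᵛ cs) ws           ∎
      where open ≡-Reasoning

  mutual
    labels-fill : ∀ t ws → labels (proj₁ (fill t ws)) ++ labelsᶠ (proj₂ (fill t ws)) ↭ labels t ++ labelsᶠ ws
    labels-fill ⊥t          []       = ↭-refl
    labels-fill ⊥t          (w ∷ ws) = ↭-refl
    labels-fill (node g cs) ws       = prep g (labelsᵛ-fillV cs ws)

    labelsᵛ-fillV : ∀ {n} (cs : Vec Term n) ws →
                    labelsᵛ (proj₁ (fillV cs ws)) ++ labelsᶠ (proj₂ (fillV cs ws)) ↭ labelsᵛ cs ++ labelsᶠ ws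
    labelsᵛ-fillV []       ws = ↭-refl
    labelsᵛ-fillV (c ∷ cs) ws = begin
      (labels c′ ++ labelsᵛ cs′) ++ labelsᶠ ws″   ≡⟨ LP.++-assoc (labels c′) _ _ ⟩
      labels c′ ++ labelsᵛ cs′ ++ labelsᶠ ws″     ↭⟨ ++⁺ˡ (labels c′) (labelsᵛ-fillV cs ws′) ⟩
      labels c′ ++ labelsᵛ cs ++ labelsᶠ ws′      ↭⟨ shifts (labels c′) (labelsᵛ cs) ⟩
      labelsᵛ cs ++ labels c′ ++ labelsᶠ ws′      ↭⟨ ++⁺ˡ (labelsᵛ cs) (labels-fill c ws) ⟩
      labelsᵛ cs ++ labels c ++ labelsᶠ ws        ↭⟨ shifts (labelsᵛ cs) (labels c) ⟩
      labels c ++ labelsᵛ cs ++ labelsᶠ ws        ≡⟨ LP.++-assoc (labels c) _ _ ⟨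
      (labels c ++ labelsᵛ cs) ++ labelsᶠ ws      ∎
      where
        open PermutationReasoning
        c′  = proj₁ (fill c ws)
        ws′ = proj₂ (fill c ws)
        cs′ = proj₁ (fillV cs ws′)
        ws″ = proj₂ (fillV cs ws′)

  labelsᵛ-replicate⊥ : ∀ n → labelsᵛ (replicate n ⊥t) ≡ []
  labelsᵛ-replicate⊥ zero    = refl
  labelsᵛ-replicate⊥ (suc n) = labelsᵛ-replicate⊥ n

  leavesᵛ-replicate⊥ : ∀ n → leavesᵛ (replicate n ⊥t) ≡ n
  leavesᵛ-replicate⊥ zero    = refl
  leavesᵛ-replicate⊥ (suc n) = cong suc (leavesᵛ-replicate⊥ n)

  labelsᵛ-graft : ∀ n (i : Fin (suc n)) t → labelsᵛ (replicate (suc n) ⊥t [ i ]≔ t) ≡ labels t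
  labelsᵛ-graft n       Fin.zero    t = trans (cong (labels t ++_) (labelsᵛ-replicate⊥ n)) (LP.++-identityʳ (labels t))
  labelsᵛ-graft (suc n) (Fin.suc i) t = labelsᵛ-graft n i t

  leavesᵛ-graft : ∀ n (i : Fin (suc n)) t → leavesᵛ (replicate (suc n) ⊥t [ i ]≔ t) ≡ leaves t + n
  leavesᵛ-graft n       Fin.zero    t = cong (leaves t +_) (leavesᵛ-replicate⊥ n)
  leavesᵛ-graft (suc n) (Fin.suc i) t = trans (cong suc (leavesᵛ-graft n i t)) (sym (ℕP.+-suc (leaves t) n))

  labels-∘ : ∀ g i g′ → labels (g ∘⟨ i ⟩ g′) ≡ g ∷ g′ ∷ []
  labels-∘ g i g′ = cong (g ∷_) (trans (labelsᵛ-graft r i (corolla g′)) (cong (g′ ∷_) (labelsᵛ-replicate⊥ (suc r))))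

  leaves-∘ : ∀ g i g′ → leaves (g ∘⟨ i ⟩ g′) ≡ suc r + r
  leaves-∘ g i g′ = trans (leavesᵛ-graft r i (corolla g′)) (cong (λ n → suc n + r) (leavesᵛ-replicate⊥ r))

  labels-gen : ∀ g g′ i i′ ws → labels ((g ∘⟨ i ⟩ g′) [ ws ]) ↭ labels ((g′ ∘⟨ i′ ⟩ g) [ ws ])
  labels-gen g g′ i i′ ws = ↭-cancelʳ (labelsᶠ rest) (begin
    labels A[ws] ++ labelsᶠ rest                  ≡⟨ cong (λ z → labels A[ws] ++ labelsᶠ z) (remainder A (leaves-∘ g i g′)) ⟨
    labels A[ws] ++ labelsᶠ (proj₂ (fill A ws))   ↭⟨ labels-fill A ws ⟩
    labels A ++ labelsᶠ ws                        ≡⟨ cong (_++ labelsᶠ ws) (labels-∘ g i g′) ⟩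
    g ∷ g′ ∷ labelsᶠ ws                           ↭⟨ swap g g′ ↭-refl ⟩
    g′ ∷ g ∷ labelsᶠ ws                           ≡⟨ cong (_++ labelsᶠ ws) (labels-∘ g′ i′ g) ⟨
    labels B ++ labelsᶠ ws                        ↭⟨ labels-fill B ws ⟨
    labels B[ws] ++ labelsᶠ (proj₂ (fill B ws))   ≡⟨ cong (λ z → labels B[ws] ++ labelsᶠ z) (remainder B (leaves-∘ g′ i′ g)) ⟩
    labels B[ws] ++ labelsᶠ rest                  ∎)
    where
      open PermutationReasoning
      A = g ∘⟨ i ⟩ g′
      B = g′ ∘⟨ i′ ⟩ g
      A[ws] = proj₁ (fill A ws)
      B[ws] = proj₁ (fill B ws)
      rest = drop (suc r + r) ws
      remainder : ∀ t → leaves t ≡ suc r + r → proj₂ (fill t ws) ≡ rest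
      remainder t eq = trans (fill-remainder t ws) (cong (λ n → drop n ws) eq)

  mutual
    ≡ₜ⇒labels↭ : ∀ {t u} → t ≡ₜ u → labels t ↭ labels u
    ≡ₜ⇒labels↭ (gen g g′ i i′ ws) = labels-gen g g′ i i′ (Vec.toList ws)
    ≡ₜ⇒labels↭ (node≡ₜ g cs≡cs′)  = prep g (Pointwise⇒labelsᵛ↭ cs≡cs′)
    ≡ₜ⇒labels↭ ≡ₜrefl             = ↭-refl
    ≡ₜ⇒labels↭ (≡ₜsym p)          = ↭-sym (≡ₜ⇒labels↭ p)
    ≡ₜ⇒labels↭ (≡ₜtrans p q)      = ↭-trans (≡ₜ⇒labels↭ p) (≡ₜ⇒labels↭ q)

    Pointwise⇒labelsᵛ↭ : ∀ {n} {cs cs′ : Vec Term n} → VPW.Pointwise _≡ₜ_ cs cs′ → labelsᵛ cs ↭ labelsᵛ cs′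
    Pointwise⇒labelsᵛ↭ VPW.[]       = ↭-refl
    Pointwise⇒labelsᵛ↭ (p VPW.∷ ps) = ++⁺ (≡ₜ⇒labels↭ p) (Pointwise⇒labelsᵛ↭ ps)

  ⊥s : ℕ → List Term
  ⊥s n = List.replicate n ⊥t

  ⊥s-+ : ∀ m n → ⊥s (m + n) ≡ ⊥s m ++ ⊥s n
  ⊥s-+ zero    n = refl
  ⊥s-+ (suc m) n = cong (⊥t ∷_) (⊥s-+ m n)

  vecOf : ∀ n (l : List Term) → length l ≡ n → ∃ λ (v : Vec Term n) → Vec.toList v ≡ l
  vecOf n l len = Vec.cast len (Vec.fromList l) , trans (VecP.toList-cast len (Vec.fromList l)) (VecP.toList∘fromList l)

  fillV-⊥s : ∀ {k} (v : Vec Term k) l ys → Vec.toList v ≡ l → fillV (replicate k ⊥t) (l ++ ys) ≡ (v , ys)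
  fillV-⊥s []      _ ys refl = refl
  fillV-⊥s (x ∷ v) _ ys refl rewrite fillV-⊥s v (Vec.toList v) ys refl = refl

  fillV-⊥s-all : ∀ {k} (v : Vec Term k) l → Vec.toList v ≡ l → fillV (replicate k ⊥t) l ≡ (v , [])
  fillV-⊥s-all v l eq = subst (λ z → fillV (replicate _ ⊥t) z ≡ (v , [])) (LP.++-identityʳ l) (fillV-⊥s v l [] eq)

  fillV-graft : ∀ n (i : Fin (suc n)) h (pre : List Term) Y k → length pre ≡ toℕ i → toℕ i + k ≡ n →
    Vec.toList (proj₁ (fillV (replicate (suc n) ⊥t [ i ]≔ corolla h) (pre ++ Y ∷ ⊥s (r + k))))
      ≡ pre ++ node h (Y ∷ replicate r ⊥t) ∷ ⊥s k
  fillV-graft n Fin.zero h [] Y k refl refl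
    rewrite ⊥s-+ r k
          | fillV-⊥s (replicate r ⊥t) (⊥s r) (⊥s k) (VecP.toList-replicate r ⊥t)
          | fillV-⊥s-all (replicate k ⊥t) (⊥s k) (VecP.toList-replicate k ⊥t)
    = cong (node h (Y ∷ replicate r ⊥t) ∷_) (VecP.toList-replicate k ⊥t)
  fillV-graft (suc n) (Fin.suc i) h (p ∷ pre) Y k len₁ len₂ =
    cong (p ∷_) (fillV-graft n i h pre Y k (ℕP.suc-injective len₁) (ℕP.suc-injective len₂))

  fill-∘-head : ∀ h g (cs : Vec Term (suc r)) →
                (h ∘⟨ Fin.zero ⟩ g) [ Vec.toList cs ++ ⊥s r ] ≡ node h (node g cs ∷ replicate r ⊥t)
  fill-∘-head h g (c ∷ cs)
    rewrite fillV-⊥s cs (Vec.toList cs) (⊥s r) refl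
          | fillV-⊥s-all (replicate r ⊥t) (⊥s r) (VecP.toList-replicate r ⊥t)
    = refl

  rotate : ∀ g h (pre : List Term) Y k → length pre + k ≡ r → ∀ (cs cs′ : Vec Term (suc r)) →
           Vec.toList cs ≡ pre ++ node h (Y ∷ replicate r ⊥t) ∷ ⊥s k → Vec.toList cs′ ≡ pre ++ Y ∷ ⊥s k →
           node g cs ≡ₜ node h (node g cs′ ∷ replicate r ⊥t)
  rotate g h pre Y k len cs cs′ eq eq′ =
    subst₂ _≡ₜ_ lhs rhs
      (subst (λ w → (g ∘⟨ i ⟩ h) [ w ] ≡ₜ (h ∘⟨ Fin.zero ⟩ g) [ w ]) toList-ws (gen g h i Fin.zero ws))
    where
      open ≡-Reasoning
      W = pre ++ Y ∷ ⊥s (r + k)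
      i : Fin (suc r)
      i = Fin.fromℕ< (s≤s (ℕP.≤-trans (ℕP.m≤m+n (length pre) k) (ℕP.≤-reflexive len)))
      W≡ : W ≡ Vec.toList cs′ ++ ⊥s r
      W≡ = begin
        pre ++ Y ∷ ⊥s (r + k)        ≡⟨ cong (λ n → pre ++ Y ∷ ⊥s n) (ℕP.+-comm r k) ⟩
        pre ++ Y ∷ ⊥s (k + r)        ≡⟨ cong (λ z → pre ++ Y ∷ z) (⊥s-+ k r) ⟩
        pre ++ (Y ∷ ⊥s k) ++ ⊥s r    ≡⟨ LP.++-assoc pre (Y ∷ ⊥s k) (⊥s r) ⟨
        (pre ++ Y ∷ ⊥s k) ++ ⊥s r    ≡⟨ cong (_++ ⊥s r) eq′ ⟨
        Vec.toList cs′ ++ ⊥s r       ∎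
      lenW : length W ≡ r + suc r
      lenW = begin
        length W                                   ≡⟨ cong length W≡ ⟩
        length (Vec.toList cs′ ++ ⊥s r)            ≡⟨ LP.length-++ (Vec.toList cs′) ⟩
        length (Vec.toList cs′) + length (⊥s r)    ≡⟨ cong₂ _+_ (VecP.length-toList cs′) (LP.length-replicate r) ⟩
        suc r + r                                  ≡⟨ ℕP.+-suc r r ⟨
        r + suc r                                  ∎
      ws = proj₁ (vecOf (r + suc r) W lenW)
      toList-ws = proj₂ (vecOf (r + suc r) W lenW)
      lhs : (g ∘⟨ i ⟩ h) [ W ] ≡ node g cs
      lhs = cong (node g) (trans (sym (VecP.cast-is-id refl _)) (VecP.toList-injective refl _ cs (trans
              (fillV-graft r i h pre Y k (sym (FinP.toℕ-fromℕ< _)) (trans (cong (_+ k) (FinP.toℕ-fromℕ< _)) len))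
              (sym eq))))
      rhs : (h ∘⟨ Fin.zero ⟩ g) [ W ] ≡ node h (node g cs′ ∷ replicate r ⊥t)
      rhs = trans (cong (λ w → (h ∘⟨ Fin.zero ⟩ g) [ w ]) W≡) (fill-∘-head h g cs′)

  chain : List (Fin s) → Term
  chain []      = ⊥t
  chain (g ∷ l) = node g (chain l ∷ replicate r ⊥t)

  chain-swap : ∀ x y l → chain (x ∷ y ∷ l) ≡ₜ chain (y ∷ x ∷ l)
  chain-swap x y l = rotate x y [] (chain l) r refl _ _
    (cong (chain (y ∷ l) ∷_) (VecP.toList-replicate r ⊥t)) (cong (chain l ∷_) (VecP.toList-replicate r ⊥t))

  chain-∷ : ∀ x {l l′} → chain l ≡ₜ chain l′ → chain (x ∷ l) ≡ₜ chain (x ∷ l′)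
  chain-∷ x p = node≡ₜ x (p VPW.∷ VPW.refl ≡ₜrefl)

  chain-↭ : ∀ {l l′} → l ↭ l′ → chain l ≡ₜ chain l′
  chain-↭ _↭_.refl          = ≡ₜrefl
  chain-↭ (prep x p)        = chain-∷ x (chain-↭ p)
  chain-↭ (swap x y p)      = ≡ₜtrans (chain-∷ x (chain-∷ y (chain-↭ p))) (chain-swap x y _)
  chain-↭ (_↭_.trans p q)   = ≡ₜtrans (chain-↭ p) (chain-↭ q)

  toList≡⊥s : ∀ {n} (v : Vec Term n) k → Vec.toList v ≡ ⊥s k → v ≡ replicate n ⊥t
  toList≡⊥s []      zero    refl = refl
  toList≡⊥s (x ∷ v) (suc k) eq   = cong₂ _∷_ (LP.∷-injectiveˡ eq) (toList≡⊥s v k (LP.∷-injectiveʳ eq))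

  map-chain-lastAt : ∀ ps x k → List.map chain (ps ++ x ∷ List.replicate k []) ≡ List.map chain ps ++ chain x ∷ ⊥s k
  map-chain-lastAt ps x k =
    trans (LP.map-++ chain ps _) (cong (λ z → List.map chain ps ++ chain x ∷ z) (LP.map-replicate chain k []))

  -- rotate the root of the last non-⊥ child to the top, then recurse below it
  node-chains : ∀ n g ls → length (concat ls) ≡ n → (cs : Vec Term (suc r)) → Vec.toList cs ≡ List.map chain ls →
                node g cs ≡ₜ chain (g ∷ concat ls)
  node-chains n g ls len cs eq with lastNonEmpty ls
  ... | allEmpty k =
    subst (λ z → node g cs ≡ₜ node g (chain z ∷ replicate r ⊥t)) (sym (concat-replicate-[] k))
          (subst (λ v → node g cs ≡ₜ node g v) (toList≡⊥s cs k (trans eq (LP.map-replicate chain k []))) ≡ₜrefl)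
  node-chains zero g _ len cs eq | lastAt ps h m k
    with () ← trans (sym len) (trans (cong length (concat-lastAt ps (h ∷ m) k)) (trans (LP.length-++ (concat ps)) (ℕP.+-suc _ _)))
  node-chains (suc n) g _ len cs eq | lastAt ps h m k =
    ≡ₜtrans (rotate g h (List.map chain ps) (chain m) k len-pre cs cs′ eq-cs eq-cs′)
            (≡ₜtrans (node≡ₜ h (node-chains n g ls′ len′ cs′ eq-ls′ VPW.∷ VPW.refl ≡ₜrefl))
                     (chain-↭ moved))
    where
      ls′ = ps ++ m ∷ List.replicate k []
      eq-cs : Vec.toList cs ≡ List.map chain ps ++ chain (h ∷ m) ∷ ⊥s k
      eq-cs = trans eq (map-chain-lastAt ps (h ∷ m) k)
      length-children : length (List.map chain ps) + suc k ≡ suc r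
      length-children = begin
        length (List.map chain ps) + suc k                               ≡⟨ cong (λ n → _ + suc n) (LP.length-replicate k) ⟨
        length (List.map chain ps) + length (chain (h ∷ m) ∷ ⊥s k)       ≡⟨ LP.length-++ (List.map chain ps) ⟨
        length (List.map chain ps ++ chain (h ∷ m) ∷ ⊥s k)               ≡⟨ cong length eq-cs ⟨
        length (Vec.toList cs)                                           ≡⟨ VecP.length-toList cs ⟩
        suc r                                                            ∎
        where open ≡-Reasoning
      len-pre : length (List.map chain ps) + k ≡ r
      len-pre = ℕP.suc-injective (trans (sym (ℕP.+-suc _ k)) length-children)
      children′ = List.map chain ps ++ chain m ∷ ⊥s k
      length-children′ : length children′ ≡ suc r
      length-children′ = trans (LP.length-++ (List.map chain ps))
                               (trans (cong (λ n → _ + suc n) (LP.length-replicate k)) length-children)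
      cs′ = proj₁ (vecOf (suc r) children′ length-children′)
      eq-cs′ : Vec.toList cs′ ≡ children′
      eq-cs′ = proj₂ (vecOf (suc r) children′ length-children′)
      eq-ls′ : Vec.toList cs′ ≡ List.map chain ls′
      eq-ls′ = trans eq-cs′ (sym (map-chain-lastAt ps m k))
      len′ : length (concat ls′) ≡ n
      len′ = ℕP.suc-injective (begin
        suc (length (concat ls′))            ≡⟨ cong (suc ∘ length) (concat-lastAt ps m k) ⟩
        suc (length (concat ps ++ m))        ≡⟨ cong suc (LP.length-++ (concat ps)) ⟩
        suc (length (concat ps) + length m)  ≡⟨ ℕP.+-suc _ _ ⟨
        length (concat ps) + length (h ∷ m)  ≡⟨ LP.length-++ (concat ps) ⟨
        length (concat ps ++ h ∷ m)          ≡⟨ cong length (concat-lastAt ps (h ∷ m) k) ⟨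
        length (concat (ps ++ (h ∷ m) ∷ List.replicate k []))  ≡⟨ len ⟩
        suc n                                ∎)
        where open ≡-Reasoning
      moved : h ∷ g ∷ concat ls′ ↭ g ∷ concat (ps ++ (h ∷ m) ∷ List.replicate k [])
      moved = begin
        h ∷ g ∷ concat ls′            ↭⟨ swap h g ↭-refl ⟩
        g ∷ h ∷ concat ls′            ≡⟨ cong (λ z → g ∷ h ∷ z) (concat-lastAt ps m k) ⟩
        g ∷ h ∷ concat ps ++ m        ↭⟨ prep g (shift h (concat ps) m) ⟨
        g ∷ concat ps ++ h ∷ m        ≡⟨ cong (g ∷_) (concat-lastAt ps (h ∷ m) k) ⟨
        g ∷ concat (ps ++ (h ∷ m) ∷ List.replicate k [])  ∎
        where open PermutationReasoning

  labelsᵛ≡concat : ∀ {n} (cs : Vec Term n) → labelsᵛ cs ≡ concat (List.map labels (Vec.toList cs))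
  labelsᵛ≡concat []       = refl
  labelsᵛ≡concat (c ∷ cs) = cong (labels c ++_) (labelsᵛ≡concat cs)

  mutual
    ≡ₜ-chain : ∀ t → t ≡ₜ chain (labels t)
    ≡ₜ-chain ⊥t          = ≡ₜrefl
    ≡ₜ-chain (node g cs) =
      ≡ₜtrans (node≡ₜ g (≡ₜ-chainᵛ cs))
              (subst (λ z → node g chains ≡ₜ chain (g ∷ z)) (sym (labelsᵛ≡concat cs))
                     (node-chains _ g (List.map labels (Vec.toList cs)) refl chains toList-chains))
      where
        chains = Vec.map (chain ∘ labels) cs
        toList-chains : Vec.toList chains ≡ List.map chain (List.map labels (Vec.toList cs))
        toList-chains = trans (VecP.toList-map (chain ∘ labels) cs) (LP.map-∘ (Vec.toList cs))

    ≡ₜ-chainᵛ : ∀ {n} (cs : Vec Term n) → VPW.Pointwise _≡ₜ_ cs (Vec.map (chain ∘ labels) cs)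
    ≡ₜ-chainᵛ []       = VPW.[]
    ≡ₜ-chainᵛ (c ∷ cs) = ≡ₜ-chain c VPW.∷ ≡ₜ-chainᵛ cs

  labels↭⇒≡ₜ : ∀ {t u} → labels t ↭ labels u → t ≡ₜ u
  labels↭⇒≡ₜ {t} {u} p = ≡ₜtrans (≡ₜ-chain t) (≡ₜtrans (chain-↭ p) (≡ₜsym (≡ₜ-chain u)))

  _≟ₜ_ : (t u : Term) → Dec (t ≡ₜ u)
  t ≟ₜ u = map′ labels↭⇒≡ₜ ≡ₜ⇒labels↭ (↭-dec Fin._≟_ (labels t) (labels u))

  _≟ᶠ_ : (f g : Forest) → Dec (f ≡F g)
  _≟ᶠ_ = LPWP.decidable _≟ₜ_

  size : Forest → ℕ
  size f = length (labelsᶠ f)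

  ≡F-refl : ∀ {f} → f ≡F f
  ≡F-refl = LPWP.refl ≡ₜrefl

  ≡F-sym : ∀ {f g} → f ≡F g → g ≡F f
  ≡F-sym = LPWP.symmetric ≡ₜsym

  ≡F-trans : ∀ {f g h} → f ≡F g → g ≡F h → f ≡F h
  ≡F-trans = LPWP.transitive ≡ₜtrans

  size-resp-≡F : ∀ {f g} → f ≡F g → size f ≡ size g
  size-resp-≡F = ↭-length ∘ labels↭
    where
      labels↭ : ∀ {f g} → f ≡F g → labelsᶠ f ↭ labelsᶠ g
      labels↭ LPW.[]       = ↭-refl
      labels↭ (t≡u LPW.∷ p) = ++⁺ (≡ₜ⇒labels↭ t≡u) (labels↭ p)

  Reduced-resp-≡F : ∀ {f g} → f ≡F g → Reduced g → Reduced f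
  Reduced-resp-≡F LPW.[]               []       = []
  Reduced-resp-≡F (t≡u LPW.∷ f≡g) (u! ∷ g!) = node-resp t≡u u! ∷ Reduced-resp-≡F f≡g g!
    where
      node-resp : ∀ {t u} → t ≡ₜ u → IsNode u → IsNode t
      node-resp {⊥t}     {node _ _} t≡u _ with () ← ↭-empty-inv (↭-sym (≡ₜ⇒labels↭ t≡u))
      node-resp {node _ _}           _   _ = _

  mutual
    _≟_ : DecidableEquality Term
    ⊥t        ≟ ⊥t          = yes refl
    ⊥t        ≟ node _ _    = no λ ()
    node _ _  ≟ ⊥t          = no λ ()
    node g cs ≟ node g′ cs′ with g Fin.≟ g′ | cs ≟ᵛ cs′
    ... | yes refl | yes refl = yes refl
    ... | no g≢g′  | _        = no λ { refl → g≢g′ refl }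
    ... | yes _    | no cs≢   = no λ { refl → cs≢ refl }

    _≟ᵛ_ : ∀ {n} → DecidableEquality (Vec Term n)
    []       ≟ᵛ []         = yes refl
    (c ∷ cs) ≟ᵛ (c′ ∷ cs′) with c ≟ c′ | cs ≟ᵛ cs′
    ... | yes refl | yes refl = yes refl
    ... | no c≢    | _        = no λ { refl → c≢ refl }
    ... | yes _    | no cs≢   = no λ { refl → cs≢ refl }

  -- Admissible words

  mutual
    AdmT-labels : ∀ {b t w} → AdmT b t w → List.map proj₁ w ≡ labels t
    AdmT-labels leaf                  = refl
    AdmT-labels (node {g = g} _ adm) = cong (g ∷_) (AdmV-labels adm)

    AdmV-labels : ∀ {b n} {cs : Vec Term n} {w} → AdmV b cs w → List.map proj₁ w ≡ labelsᵛ cs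
    AdmV-labels []                      = refl
    AdmV-labels (_∷_ {u₁ = u₁} adm adms) = trans (LP.map-++ proj₁ u₁ _) (cong₂ _++_ (AdmT-labels adm) (AdmV-labels adms))

  AdmF-labels : ∀ {f w} → AdmF f w → List.map proj₁ w ≡ labelsᶠ f
  AdmF-labels []                      = refl
  AdmF-labels (_∷_ {u₁ = u₁} adm adms) = trans (LP.map-++ proj₁ u₁ _) (cong₂ _++_ (AdmT-labels adm) (AdmF-labels adms))

  mutual
    AdmT-bound : ∀ {b t w} → AdmT b t w → All (λ a → b ≤ proj₂ a) w
    AdmT-bound leaf                 = []
    AdmT-bound (node {i = i} b≤i adm) = b≤i ∷ All.map (λ i<j → ℕP.≤-trans b≤i (ℕP.<⇒≤ i<j)) (AdmV-bound adm)

    AdmV-bound : ∀ {b n} {cs : Vec Term n} {w} → AdmV b cs w → All (λ a → b ≤ proj₂ a) w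
    AdmV-bound []           = []
    AdmV-bound (adm ∷ adms) = AllP.++⁺ (AdmT-bound adm) (AdmV-bound adms)

  AdmV-∷⁻ : ∀ {b n c} {cs : Vec Term n} {w} → AdmV b (c ∷ cs) w →
            ∃₂ λ u₁ u₂ → w ≡ u₁ ++ u₂ × AdmT b c u₁ × AdmV b cs u₂
  AdmV-∷⁻ (adm ∷ adms) = _ , _ , refl , adm , adms

  AdmF-∷⁻ : ∀ {t f w} → AdmF (t ∷ f) w → ∃₂ λ u₁ u₂ → w ≡ u₁ ++ u₂ × AdmT 0 t u₁ × AdmF f u₂
  AdmF-∷⁻ (adm ∷ adms) = _ , _ , refl , adm , adms

  mutual
    AdmT? : ∀ b t w → Dec (AdmT b t w)
    AdmT? b ⊥t          []              = yes leaf
    AdmT? b ⊥t          (_ ∷ _)         = no λ ()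
    AdmT? b (node g cs) []              = no λ ()
    AdmT? b (node g cs) ((g′ , i) ∷ w) with g Fin.≟ g′ | b ℕ.≤? i | AdmV? (suc i) cs w
    ... | yes refl | yes b≤i | yes adm = yes (node b≤i adm)
    ... | no g≢g′  | _       | _       = no λ { (node _ _) → g≢g′ refl }
    ... | yes _    | no b≰i  | _       = no λ { (node b≤i _) → b≰i b≤i }
    ... | yes _    | yes _   | no ¬adm = no λ { (node _ adm) → ¬adm adm }

    AdmV? : ∀ b {n} (cs : Vec Term n) w → Dec (AdmV b cs w)
    AdmV? b []       []      = yes []
    AdmV? b []       (_ ∷ _) = no λ ()
    AdmV? b (c ∷ cs) w       = map′ (λ { (_ , _ , refl , adm , adms) → adm ∷ adms }) AdmV-∷⁻
                                    (++-split? (AdmT? b c) (AdmV? b cs) w)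

  AdmF? : ∀ f w → Dec (AdmF f w)
  AdmF? []      []      = yes []
  AdmF? []      (_ ∷ _) = no λ ()
  AdmF? (t ∷ f) w       = map′ (λ { (_ , _ , refl , adm , adms) → adm ∷ adms }) AdmF-∷⁻
                               (++-split? (AdmT? 0 t) (AdmF? f) w)

  mutual
    termsOfHeight : ℕ → List Term
    termsOfHeight zero    = ⊥t ∷ []
    termsOfHeight (suc n) = ⊥t ∷ List.cartesianProductWith node (List.allFin s) (vecsOfHeight (suc r) n)

    vecsOfHeight : ∀ k → ℕ → List (Vec Term k)
    vecsOfHeight zero    n = [] ∷ []
    vecsOfHeight (suc k) n = List.cartesianProductWith _∷_ (termsOfHeight n) (vecsOfHeight k n)

  forestsOfHeight : ℕ → ℕ → List Forest
  forestsOfHeight zero    n = [] ∷ []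
  forestsOfHeight (suc ℓ) n = List.cartesianProductWith _∷_ (termsOfHeight n) (forestsOfHeight ℓ n)

  mutual
    ∈-termsOfHeight : ∀ n t → length (labels t) ≤ n → t ∈ termsOfHeight n
    ∈-termsOfHeight zero    ⊥t          _         = here refl
    ∈-termsOfHeight (suc n) ⊥t          _         = here refl
    ∈-termsOfHeight (suc n) (node g cs) (s≤s le) = there (∈-cartesianProductWith⁺ node (∈-allFin g) (∈-vecsOfHeight n cs le))

    ∈-vecsOfHeight : ∀ n {k} (cs : Vec Term k) → length (labelsᵛ cs) ≤ n → cs ∈ vecsOfHeight k n
    ∈-vecsOfHeight n []       _  = here refl
    ∈-vecsOfHeight n (c ∷ cs) le with le₁ , le₂ ← length-++-≤ (labels c) (labelsᵛ cs) le =
      ∈-cartesianProductWith⁺ _∷_ (∈-termsOfHeight n c le₁) (∈-vecsOfHeight n cs le₂)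

  ∈-forestsOfHeight : ∀ n f → size f ≤ n → f ∈ forestsOfHeight (length f) n
  ∈-forestsOfHeight n []      _  = here refl
  ∈-forestsOfHeight n (t ∷ f) le with le₁ , le₂ ← length-++-≤ (labels t) (labelsᶠ f) le =
    ∈-cartesianProductWith⁺ _∷_ (∈-termsOfHeight n t le₁) (∈-forestsOfHeight n f le₂)

  AdmF-length : ∀ {f w} → AdmF f w → length w ≡ size f
  AdmF-length {w = w} adm = trans (sym (LP.length-map proj₁ w)) (cong length (AdmF-labels adm))

  -- finite, since a forest admitting u has length u nodes and so bounded height
  classCoeff : ∀ f u → ∃ (ClassCoeff f u)
  classCoeff f u = Count-exhaustive (LP.≡-dec _≟_) (λ f′ → (f′ ≟ᶠ f) ×-dec AdmF? f′ u)
                                    (forestsOfHeight (length f) (length u)) complete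
    where
      complete : ∀ {f′} → f′ ≡F f × AdmF f′ u → f′ ∈ forestsOfHeight (length f) (length u)
      complete {f′} (f′≡f , adm) =
        subst (λ ℓ → f′ ∈ forestsOfHeight ℓ (length u)) (LPW.Pointwise-length f′≡f)
              (∈-forestsOfHeight (length u) f′ (ℕP.≤-reflexive (sym (AdmF-length adm))))

  ClassCoeff-resp-≡F : ∀ {f g u n} → f ≡F g → ClassCoeff f u n → ClassCoeff g u n
  ClassCoeff-resp-≡F f≡g = Count-resp λ _ →
    mk⇔ (λ { (f′≡f , adm) → ≡F-trans f′≡f f≡g , adm }) (λ { (f′≡g , adm) → ≡F-trans f′≡g (≡F-sym f≡g) , adm })

  -- The canonical word of a forest

  ascending : ℕ → List (Fin s) → Word
  ascending b []       = []
  ascending b (g ∷ gs) = (g , b) ∷ ascending (suc b) gs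

  canonical : Forest → Word
  canonical []      = []
  canonical (t ∷ f) = ascending (size f) (labels t) ++ canonical f

  map-proj₁-ascending : ∀ b gs → List.map proj₁ (ascending b gs) ≡ gs
  map-proj₁-ascending b []       = refl
  map-proj₁-ascending b (g ∷ gs) = cong (g ∷_) (map-proj₁-ascending (suc b) gs)

  ascending-++ : ∀ c (gs hs : List (Fin s)) → ascending c (gs ++ hs) ≡ ascending c gs ++ ascending (c + length gs) hs
  ascending-++ c []       hs = cong (λ n → ascending n hs) (sym (ℕP.+-identityʳ c))
  ascending-++ c (g ∷ gs) hs =
    cong ((g , c) ∷_) (trans (ascending-++ (suc c) gs hs)
                             (cong (λ n → ascending (suc c) gs ++ ascending n hs) (sym (ℕP.+-suc c (length gs)))))

  ascending-bound : ∀ b gs → All (λ a → proj₂ a < b + length gs) (ascending b gs)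
  ascending-bound b []       = []
  ascending-bound b (g ∷ gs) = subst (b <_) (sym (ℕP.+-suc b (length gs))) (s≤s (ℕP.m≤m+n b (length gs)))
    ∷ All.map (λ i< → ℕP.≤-trans i< (ℕP.≤-reflexive (sym (ℕP.+-suc b (length gs))))) (ascending-bound (suc b) gs)

  canonical-bound : ∀ f → All (λ a → proj₂ a < size f) (canonical f)
  canonical-bound []      = []
  canonical-bound (t ∷ f) = AllP.++⁺
    (All.map (λ i< → ℕP.<-≤-trans i< (ℕP.≤-reflexive (trans (ℕP.+-comm (size f) _) (sym (LP.length-++ (labels t))))))
             (ascending-bound (size f) (labels t)))
    (All.map (λ i< → ℕP.<-≤-trans i< (ℕP.≤-trans (ℕP.m≤n+m (size f) _) (ℕP.≤-reflexive (sym (LP.length-++ (labels t))))))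
             (canonical-bound f))

  mutual
    AdmT-ascending : ∀ t {b c} → b ≤ c → AdmT b t (ascending c (labels t))
    AdmT-ascending ⊥t          _   = leaf
    AdmT-ascending (node g cs) b≤c = node b≤c (AdmV-ascending cs ℕP.≤-refl)

    AdmV-ascending : ∀ {n} (cs : Vec Term n) {b c} → b ≤ c → AdmV b cs (ascending c (labelsᵛ cs))
    AdmV-ascending []           _   = []
    AdmV-ascending (t ∷ cs) {c = c} b≤c = subst (AdmV _ (t ∷ cs)) (sym (ascending-++ c (labels t) (labelsᵛ cs)))
      (AdmT-ascending t b≤c ∷ AdmV-ascending cs (ℕP.≤-trans b≤c (ℕP.m≤m+n c _)))

  AdmF-canonical : ∀ f → AdmF f (canonical f)
  AdmF-canonical []      = []
  AdmF-canonical (t ∷ f) = AdmT-ascending t z≤n ∷ AdmF-canonical f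

  ascending-split : ∀ {B} c gs (u₁ u₂ W : Word) → B ≤ c → All (λ a → B ≤ proj₂ a) u₁ → All (λ a → proj₂ a < B) W →
                    u₁ ++ u₂ ≡ ascending c gs ++ W →
                    ∃ λ k → u₁ ≡ ascending c (List.take k gs) × u₂ ≡ ascending (c + k) (List.drop k gs) ++ W
  ascending-split c gs       []       u₂ W _ _ _ eq = 0 , refl , trans eq (cong (λ n → ascending n gs ++ W) (sym (ℕP.+-identityʳ c)))
  ascending-split c []       (a ∷ u₁) u₂ [] _ _ _ ()
  ascending-split c []       (a ∷ u₁) u₂ (a′ ∷ W) _ (B≤a ∷ _) (a′<B ∷ _) eq with refl ← LP.∷-injectiveˡ eq =
    ⊥-elim (ℕP.<-irrefl refl (ℕP.<-≤-trans a′<B B≤a))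
  ascending-split c (g ∷ gs) (a ∷ u₁) u₂ W B≤c (_ ∷ B≤u₁) W<B eq
    with refl ← LP.∷-injectiveˡ eq
    with k , eq₁ , eq₂ ← ascending-split (suc c) gs u₁ u₂ W (ℕP.m≤n⇒m≤1+n B≤c) B≤u₁ W<B (LP.∷-injectiveʳ eq) =
    suc k , cong (a ∷_) eq₁ , trans eq₂ (cong (λ n → ascending n (List.drop k gs) ++ W) (sym (ℕP.+-suc c k)))

  -- every tree boundary of f is one of f′, since there the index drops below that of every earlier root
  mutual
    AdmF-run : ∀ fuel g gs b f f′ → length (g ∷ gs) ≤ fuel → Reduced f → Reduced f′ → size f ≤ b →
               AdmF f′ (ascending b (g ∷ gs) ++ canonical f) → length f′ ≤ suc (length f) →
               ∃₂ λ t′ f″ → f′ ≡ t′ ∷ f″ × labels t′ ≡ g ∷ gs × f″ ≡F f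
    AdmF-run zero       _ _  _ _ _                  ()    _  _         _      _   _
    AdmF-run (suc fuel) _ _  _ _ []                 _     _  _         _      ()  _
    AdmF-run (suc fuel) _ _  _ _ (⊥t ∷ _)           _     _  (() ∷ _)  _      _   _
    AdmF-run (suc fuel) g gs b f (node g₁ cs₁ ∷ f″) fuel≥ f! (_ ∷ f″!) size≤b adm len
      with _ , u₂ , eq , node {u = u₁} _ adm-cs , adm-f″ ← AdmF-∷⁻ adm
      with refl ← LP.∷-injectiveˡ eq
      with k , eq₁ , eq₂ ← ascending-split (suc b) gs u₁ u₂ (canonical f) ℕP.≤-refl (AdmV-bound adm-cs)
                             (All.map (λ i< → ℕP.<-≤-trans i< (ℕP.m≤n⇒m≤1+n size≤b)) (canonical-bound f))
                             (sym (LP.∷-injectiveʳ eq))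
      with List.drop k gs in drop≡
    ... | [] = node g cs₁ , f″ , refl , cong (g ∷_) labels-cs₁ ,
               canonical-rigid f f″ f! f″! (subst (AdmF f″) eq₂ adm-f″) (ℕP.≤-pred len)
      where
        labels-cs₁ : labelsᵛ cs₁ ≡ gs
        labels-cs₁ = begin
          labelsᵛ cs₁                                          ≡⟨ AdmV-labels adm-cs ⟨
          List.map proj₁ u₁                                    ≡⟨ cong (List.map proj₁) eq₁ ⟩
          List.map proj₁ (ascending (suc b) (List.take k gs))  ≡⟨ map-proj₁-ascending (suc b) (List.take k gs) ⟩
          List.take k gs                                       ≡⟨ LP.++-identityʳ _ ⟨
          List.take k gs ++ []                                 ≡⟨ cong (List.take k gs ++_) drop≡ ⟨
          List.take k gs ++ List.drop k gs                     ≡⟨ LP.take++drop≡id k gs ⟩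
          gs                                                   ∎
          where open ≡-Reasoning
    ... | g₂ ∷ gs₂
      with _ , f₃ , refl , _ , f₃≡f ← AdmF-run fuel g₂ gs₂ (suc b + k) f f″
                                        (ℕP.≤-trans (ℕP.≤-reflexive (trans (cong length (sym drop≡)) (LP.length-drop k gs)))
                                                    (ℕP.≤-trans (ℕP.m∸n≤m (length gs) k) (ℕP.≤-pred fuel≥)))
                                        f! f″! (ℕP.≤-trans size≤b (ℕP.≤-trans (ℕP.n≤1+n b) (ℕP.m≤m+n (suc b) k)))
                                        (subst (AdmF f″) eq₂ adm-f″) (ℕP.m≤n⇒m≤1+n (ℕP.≤-pred len))
      = ⊥-elim (ℕP.<⇒≢ (ℕP.≤-pred len) (LPW.Pointwise-length f₃≡f))

    canonical-rigid : ∀ f f′ → Reduced f → Reduced f′ → AdmF f′ (canonical f) → length f′ ≤ length f → f′ ≡F f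
    canonical-rigid []              []      _        _   _   _   = LPW.[]
    canonical-rigid []              (_ ∷ _) _        _   _   ()
    canonical-rigid (⊥t ∷ _)        _       (() ∷ _) _   _   _
    canonical-rigid (node g cs ∷ f) f′      (_ ∷ f!) f′! adm len
      with t′ , f″ , refl , labels≡ , f″≡f ← AdmF-run _ g (labelsᵛ cs) (size f) f f′ ℕP.≤-refl f! f′! ℕP.≤-refl adm len
      = labels↭⇒≡ₜ (↭-reflexive labels≡) LPW.∷ f″≡f

  -- The product formula

  AdmF-++⁺ : ∀ {f g w₁ w₂} → AdmF f w₁ → AdmF g w₂ → AdmF (f ++ g) (w₁ ++ w₂)
  AdmF-++⁺ []                               adm₂ = adm₂
  AdmF-++⁺ {w₂ = w₂} (_∷_ {u₁ = u₁} {u₂} adm adms) adm₂ =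
    subst (AdmF _) (sym (LP.++-assoc u₁ u₂ w₂)) (adm ∷ AdmF-++⁺ adms adm₂)

  AdmF-++⁻ : ∀ f {g w} → AdmF (f ++ g) w → ∃₂ λ w₁ w₂ → w ≡ w₁ ++ w₂ × AdmF f w₁ × AdmF g w₂
  AdmF-++⁻ []      adm = [] , _ , refl , [] , adm
  AdmF-++⁻ (t ∷ f) adm
    with u₁ , _ , refl , adm-t , adm-f ← AdmF-∷⁻ adm
    with w₁ , w₂ , refl , adm₁ , adm₂ ← AdmF-++⁻ f adm-f =
    u₁ ++ w₁ , w₂ , sym (LP.++-assoc u₁ w₁ w₂) , adm-t ∷ adm₁ , adm₂

  size-++ : ∀ f g → size (f ++ g) ≡ size f + size g
  size-++ f g = trans (cong length (labelsᶠ-++ f)) (LP.length-++ (labelsᶠ f))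
    where
      labelsᶠ-++ : ∀ f → labelsᶠ (f ++ g) ≡ labelsᶠ f ++ labelsᶠ g
      labelsᶠ-++ []      = refl
      labelsᶠ-++ (t ∷ f) = trans (cong (labels t ++_) (labelsᶠ-++ f)) (sym (LP.++-assoc (labels t) _ _))

  ClassCoeff-≢size : ∀ {f w n} → ClassCoeff f w n → length w ≢ size f → n ≡ 0
  ClassCoeff-≢size cf ≢size = Count-empty (λ { _ (f′≡f , adm) → ≢size (trans (AdmF-length adm) (size-resp-≡F f′≡f)) }) cf

  class-++⇔ : ∀ f g {w₁ w₂} → length w₁ ≡ size f → ∀ f′ →
              (f′ ≡F f ++ g × AdmF f′ (w₁ ++ w₂)) ⇔
              (∃₂ λ p q → (p ≡F f × AdmF p w₁) × (q ≡F g × AdmF q w₂) × f′ ≡ p ++ q)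
  class-++⇔ f g {w₁} {w₂} len f′ = mk⇔ split (λ { (p , q , (p≡f , adm₁) , (q≡g , adm₂) , refl) →
                                                    LPW.++⁺ p≡f q≡g , AdmF-++⁺ adm₁ adm₂ })
    where
      split : f′ ≡F f ++ g × AdmF f′ (w₁ ++ w₂) → _
      split (f′≡ , adm)
        with p , q , refl , p≡f , q≡g ← Pointwise-++⁻ f f′≡
        with v₁ , v₂ , eq , adm₁ , adm₂ ← AdmF-++⁻ p adm
        with refl , refl ← ++-injective v₁ w₁ (trans (AdmF-length adm₁) (trans (size-resp-≡F p≡f) (sym len))) (sym eq) =
        p , q , (p≡f , adm₁) , (q≡g , adm₂) , refl

  ClassCoeff-++ : ∀ f g {w₁ w₂ m n} → length w₁ ≡ size f → ClassCoeff f w₁ m → ClassCoeff g w₂ n →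
                  ClassCoeff (f ++ g) (w₁ ++ w₂) (m * n)
  ClassCoeff-++ f g len cf cg = Count-resp (λ f′ → Function.Properties.Equivalence.sym (class-++⇔ f g len f′))
    (Count-++ (λ { (p≡f , _) → LPW.Pointwise-length p≡f }) cf cg)

  SplitSum-≢size : ∀ {f g ps m} → All (λ p → length (proj₁ p) ≢ size f) ps → SplitSum f g ps m → m ≡ 0
  SplitSum-≢size []           []                          = refl
  SplitSum-≢size (≢size ∷ ≢s) (_∷_ {n₂ = n₂} cf _ ss) =
    cong₂ _+_ (cong (_* n₂) (ClassCoeff-≢size cf ≢size)) (SplitSum-≢size ≢s ss)

  ClassCoeff-++-at : ∀ f g pre u {n n₁ n₂} → length pre ≡ size f → ClassCoeff (f ++ g) (pre ++ u) n →
                     ClassCoeff f (pre ++ []) n₁ → ClassCoeff g u n₂ → n ≡ n₁ * n₂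
  ClassCoeff-++-at f g pre u len cn cf cg = Count-functional cn
    (subst (λ w → ClassCoeff (f ++ g) w _) (cong (_++ u) (LP.++-identityʳ pre))
           (ClassCoeff-++ f g (trans (cong length (LP.++-identityʳ pre)) len) cf cg))

  -- only the split at length size f contributes to the sum over the splittings of a word
  SplitSum-prefixed : ∀ f g pre u → length pre ≤ size f → ∀ {m n} →
                      SplitSum f g (prefixed pre (splits u)) m → ClassCoeff (f ++ g) (pre ++ u) n → n ≡ m
  SplitSum-prefixed f g pre u pre≤ ss cn with length pre ℕ.≟ size f
  SplitSum-prefixed f g pre [] pre≤ (_∷_ {n₁ = n₁} {n₂} cf cg []) cn | yes pre≡ =
    trans (ClassCoeff-++-at f g pre [] pre≡ cn cf cg) (sym (ℕP.+-identityʳ _))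
  SplitSum-prefixed f g pre (a ∷ u) pre≤ (_∷_ {n₁ = n₁} {n₂} cf cg ss) cn | yes pre≡ =
    trans (ClassCoeff-++-at f g pre (a ∷ u) pre≡ cn cf cg)
          (sym (trans (cong (n₁ * n₂ +_) (SplitSum-≢size (prefixed-∷-longer pre a (splits u) pre≡) ss)) (ℕP.+-identityʳ _)))
  SplitSum-prefixed f g pre [] pre≤ (_∷_ {n₂ = n₂} cf cg []) cn | no pre≢ =
    trans (ClassCoeff-≢size (subst (λ w → ClassCoeff (f ++ g) w _) (LP.++-identityʳ pre) cn) shorter)
          (cong (λ n₁ → n₁ * n₂ + 0) (sym (ClassCoeff-≢size cf (pre≢ ∘ trans (sym (cong length (LP.++-identityʳ pre)))))))
    where
      shorter : length pre ≢ size (f ++ g)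
      shorter = ℕP.<⇒≢ (ℕP.<-≤-trans (ℕP.≤∧≢⇒< pre≤ pre≢)
                                     (ℕP.≤-trans (ℕP.m≤m+n (size f) (size g)) (ℕP.≤-reflexive (sym (size-++ f g)))))
  SplitSum-prefixed f g pre (a ∷ u) pre≤ (_∷_ {n₂ = n₂} {m = m} cf cg ss) cn | no pre≢ =
    trans (SplitSum-prefixed f g (pre ++ a ∷ []) u pre≤′ (subst (λ ps → SplitSum f g ps m) (prefixed-∷ pre a (splits u)) ss)
                             (subst (λ w → ClassCoeff (f ++ g) w _) (sym (LP.++-assoc pre (a ∷ []) u)) cn))
          (cong (λ n₁ → n₁ * n₂ + m) (sym (ClassCoeff-≢size cf (pre≢ ∘ trans (sym (cong length (LP.++-identityʳ pre)))))))
    where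
      pre≤′ : length (pre ++ a ∷ []) ≤ size f
      pre≤′ = ℕP.≤-trans (ℕP.≤-reflexive (trans (LP.length-++ pre) (ℕP.+-comm (length pre) 1))) (ℕP.≤∧≢⇒< pre≤ pre≢)

  ClassCoeff-++-splits : ∀ f g u {m n} → ClassCoeff (f ++ g) u n → SplitSum f g (splits u) m → n ≡ m
  ClassCoeff-++-splits f g u {m} cn ss =
    SplitSum-prefixed f g [] u z≤n (subst (λ ps → SplitSum f g ps m) (sym (LP.map-id (splits u))) ss) cn

  -- Injectivity

  module Injectivity {c ℓ : Level} (K : CommutativeRing c ℓ) (K-field : IsFieldChar0 K) where
    open Lin K
    open CommutativeRing K
      using (_≈_; 0#; 1#; setoid; +-cong; +-congˡ; +-congʳ; +-assoc; +-comm; +-identityˡ; +-identityʳ;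
             *-congˡ; *-congʳ; *-assoc; *-identityʳ; zeroˡ; zeroʳ; distribʳ)
      renaming (_+_ to _⊕_; _*_ to _⊛_; refl to ≈-refl; sym to ≈-sym; trans to ≈-trans; reflexive to ≈-reflexive)
    open IsFieldChar0 K-field
    open import Relation.Binary.Reasoning.Setoid setoid

    ClassZero : Forest → Combo → Set (c ⊔ ℓ)
    ClassZero f x = ∀ k → SumClass f x k → k ≈ 0#

    CoeffZero : Forest → Word → Set
    CoeffZero f u = ∀ n → ClassCoeff f u n → n ≡ 0

    coeffΦ : ∀ u x → ∃ (CoeffΦ u x)
    coeffΦ u []            = 0# , []
    coeffΦ u ((a , f) ∷ x) with n , cf ← classCoeff f u | κ , cx ← coeffΦ u x = a ⊛ fromℕ K n ⊕ κ , cf ∷ cx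

    sumClass : ∀ f x → ∃ (SumClass f x)
    sumClass f []            = 0# , []
    sumClass f ((a , g) ∷ x) with g ≟ᶠ f | sumClass f x
    ... | yes g≡f | k , sx = a ⊕ k , yes∷ g≡f sx
    ... | no g≢f  | k , sx = k , no∷ g≢f sx

    dropClass : Forest → Combo → Combo
    dropClass f = List.filter (λ e → ¬? (proj₂ e ≟ᶠ f))

    dropClass-∈ : ∀ f x {a g} → (a , g) ∈ dropClass f x → (a , g) ∈ x × ¬ (g ≡F f)
    dropClass-∈ f x = ∈-filter⁻ (λ e → ¬? (proj₂ e ≟ᶠ f)) {xs = x}

    dropClass-self : ∀ a f x → length (dropClass f ((a , f) ∷ x)) ≤ length x
    dropClass-self a f x rewrite LP.filter-reject (λ e → ¬? (proj₂ e ≟ᶠ f)) {x = a , f} {xs = x} (λ f≢f → f≢f ≡F-refl) =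
      LP.length-filter (λ e → ¬? (proj₂ e ≟ᶠ f)) x

    SumClass-dropClass : ∀ f x {g k} → ¬ (g ≡F f) → SumClass g (dropClass f x) k → SumClass g x k
    SumClass-dropClass f []            g≢f sx = sx
    SumClass-dropClass f ((a , h) ∷ x) g≢f sx with h ≟ᶠ f
    ... | yes h≡f = no∷ (λ h≡g → g≢f (≡F-trans (≡F-sym h≡g) h≡f)) (SumClass-dropClass f x g≢f sx)
    SumClass-dropClass f ((a , h) ∷ x) g≢f (yes∷ h≡g sx) | no _ = yes∷ h≡g (SumClass-dropClass f x g≢f sx)
    SumClass-dropClass f ((a , h) ∷ x) g≢f (no∷ h≢g sx)  | no _ = no∷ h≢g (SumClass-dropClass f x g≢f sx)

    CoeffΦ-split : ∀ {u f n} → ClassCoeff f u n → ∀ {x κ k} → CoeffΦ u x κ → SumClass f x k →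
                   ∃ λ κ′ → CoeffΦ u (dropClass f x) κ′ × κ ≈ k ⊛ fromℕ K n ⊕ κ′
    CoeffΦ-split cf [] [] = 0# , [] , ≈-sym (≈-trans (+-identityʳ _) (zeroˡ _))
    CoeffΦ-split {f = f} {n} cf {(a , g) ∷ x} (_∷_ {n = m} {k = κ} cg cx) sx with g ≟ᶠ f | sx
    ... | yes g≡f | no∷ g≢f _ = ⊥-elim (g≢f g≡f)
    ... | no g≢f  | yes∷ g≡f _ = ⊥-elim (g≢f g≡f)
    ... | yes g≡f | yes∷ {k = k} _ sx′ with κ′ , cx′ , κ≈ ← CoeffΦ-split cf cx sx′ = κ′ , cx′ , (begin
      a ⊛ fromℕ K m ⊕ κ                          ≈⟨ +-cong (≈-reflexive (cong (λ m → a ⊛ fromℕ K m) m≡n)) κ≈ ⟩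
      a ⊛ fromℕ K n ⊕ (k ⊛ fromℕ K n ⊕ κ′)       ≈⟨ +-assoc _ _ _ ⟨
      (a ⊛ fromℕ K n ⊕ k ⊛ fromℕ K n) ⊕ κ′       ≈⟨ +-congʳ (distribʳ (fromℕ K n) a k) ⟨
      (a ⊕ k) ⊛ fromℕ K n ⊕ κ′                   ∎)
      where m≡n = Count-functional (ClassCoeff-resp-≡F g≡f cg) cf
    ... | no g≢f  | no∷ {k = k} _ sx′ with κ′ , cx′ , κ≈ ← CoeffΦ-split cf cx sx′ =
      a ⊛ fromℕ K m ⊕ κ′ , cg ∷ cx′ , (begin
      a ⊛ fromℕ K m ⊕ κ                          ≈⟨ +-congˡ κ≈ ⟩
      a ⊛ fromℕ K m ⊕ (k ⊛ fromℕ K n ⊕ κ′)       ≈⟨ +-assoc _ _ _ ⟨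
      (a ⊛ fromℕ K m ⊕ k ⊛ fromℕ K n) ⊕ κ′       ≈⟨ +-congʳ (+-comm _ _) ⟩
      (k ⊛ fromℕ K n ⊕ a ⊛ fromℕ K m) ⊕ κ′       ≈⟨ +-assoc _ _ _ ⟩
      k ⊛ fromℕ K n ⊕ (a ⊛ fromℕ K m ⊕ κ′)       ∎)

    CoeffΦ-vanishes : ∀ u fuel x {κ} → length x ≤ fuel → CoeffΦ u x κ →
                      (∀ {a g} → (a , g) ∈ x → CoeffZero g u ⊎ ClassZero g x) → κ ≈ 0#
    CoeffΦ-vanishes u fuel       []            _   []  _     = ≈-refl
    CoeffΦ-vanishes u (suc fuel) ((a , g) ∷ x) len cx zero?
      with n , cg ← classCoeff g u | k , sx ← sumClass g ((a , g) ∷ x)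
      with κ′ , cx′ , κ≈ ← CoeffΦ-split cg cx sx = begin
        _                     ≈⟨ κ≈ ⟩
        k ⊛ fromℕ K n ⊕ κ′    ≈⟨ +-cong head rest ⟩
        0# ⊕ 0#               ≈⟨ +-identityˡ 0# ⟩
        0#                    ∎
      where
        head : k ⊛ fromℕ K n ≈ 0#
        head with zero? (here refl)
        ... | inj₁ coeff0 = ≈-trans (*-congˡ (≈-reflexive (cong (fromℕ K) (coeff0 n cg)))) (zeroʳ k)
        ... | inj₂ class0 = ≈-trans (*-congʳ (class0 k sx)) (zeroˡ _)
        zero?′ : ∀ {a′ g′} → (a′ , g′) ∈ dropClass g ((a , g) ∷ x) →
                 CoeffZero g′ u ⊎ ClassZero g′ (dropClass g ((a , g) ∷ x))
        zero?′ e∈ with e∈x , g′≢g ← dropClass-∈ g ((a , g) ∷ x) e∈ with zero? e∈x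
        ... | inj₁ coeff0 = inj₁ coeff0
        ... | inj₂ class0 = inj₂ λ k′ sx′ → class0 k′ (SumClass-dropClass g _ g′≢g sx′)
        rest : κ′ ≈ 0#
        rest = CoeffΦ-vanishes u fuel (dropClass g ((a , g) ∷ x)) (ℕP.≤-trans (dropClass-self a g x) (ℕP.≤-pred len)) cx′ zero?′

    cancel-fromℕ : ∀ n k → k ⊛ fromℕ K (suc n) ≈ 0# → k ≈ 0#
    cancel-fromℕ n k k·n≈0 with y , n·y≈1 ← inverse (fromℕ K (suc n)) (char0 n) = begin
      k                             ≈⟨ *-identityʳ k ⟨
      k ⊛ 1#                        ≈⟨ *-congˡ n·y≈1 ⟨
      k ⊛ (fromℕ K (suc n) ⊛ y)     ≈⟨ *-assoc _ _ _ ⟨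
      (k ⊛ fromℕ K (suc n)) ⊛ y     ≈⟨ *-congʳ k·n≈0 ⟩
      0# ⊛ y                        ≈⟨ zeroˡ y ⟩
      0#                            ∎

    totalLength : Combo → ℕ
    totalLength []            = 0
    totalLength ((_ , g) ∷ x) = length g + totalLength x

    ClassZero-long : ∀ x {f} → totalLength x < length f → ClassZero f x
    ClassZero-long []            _ _ []             = ≈-refl
    ClassZero-long ((a , g) ∷ x) long k (yes∷ g≡f _) =
      ⊥-elim (ℕP.<⇒≢ (ℕP.≤-<-trans (ℕP.m≤m+n (length g) _) long) (LPW.Pointwise-length g≡f))
    ClassZero-long ((a , g) ∷ x) long k (no∷ _ sx)  = ClassZero-long x (ℕP.≤-<-trans (ℕP.m≤n+m _ (length g)) long) k sx

    -- at the canonical word of f, classes with more trees vanish by induction on d, and the other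
    -- classes with at most as many trees as f do not occur, by rigidity
    module _ (x : Combo) (x! : ReducedCombo x) (Φx≈0 : IsZeroΦ x) where
      ClassZero-all : ∀ d f → Reduced f → totalLength x < length f + d → ClassZero f x
      ClassZero-all zero    f f! long = ClassZero-long x (subst (totalLength x <_) (ℕP.+-identityʳ _) long)
      ClassZero-all (suc d) f f! long k sx
        with n , cf ← classCoeff f (canonical f)
        with n′ , refl ← Count-inhabited (≡F-refl , AdmF-canonical f) cf
        with κ , cx ← coeffΦ (canonical f) x
        with κ′ , cx′ , κ≈ ← CoeffΦ-split cf cx sx
        = cancel-fromℕ n′ k (begin
            k ⊛ fromℕ K (suc n′)        ≈⟨ +-identityʳ _ ⟨
            k ⊛ fromℕ K (suc n′) ⊕ 0#   ≈⟨ +-congˡ κ′≈0 ⟨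
            k ⊛ fromℕ K (suc n′) ⊕ κ′   ≈⟨ κ≈ ⟨
            κ                           ≈⟨ Φx≈0 (canonical f) κ cx ⟩
            0#                          ∎)
        where
          others : ∀ {a g} → (a , g) ∈ dropClass f x → CoeffZero g (canonical f) ⊎ ClassZero g (dropClass f x)
          others {g = g} e∈ with e∈x , g≢f ← dropClass-∈ f x e∈ with length g ℕ.≤? length f
          ... | yes short = inj₁ λ _ → Count-empty λ { f′ (f′≡g , adm) → g≢f (≡F-trans (≡F-sym f′≡g)
                  (canonical-rigid f f′ f! (Reduced-resp-≡F f′≡g (All.lookup x! e∈x)) adm
                                   (ℕP.≤-trans (ℕP.≤-reflexive (LPW.Pointwise-length f′≡g)) short))) }
          ... | no long-g = inj₂ λ k′ sx′ → ClassZero-all d _ (All.lookup x! e∈x)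
                  (ℕP.≤-trans (s≤s (ℕP.≤-pred (subst (totalLength x <_) (ℕP.+-suc (length f) d) long)))
                              (ℕP.+-monoˡ-≤ d (ℕP.≰⇒> long-g)))
                  k′ (SumClass-dropClass f x g≢f sx′)
          κ′≈0 : κ′ ≈ 0#
          κ′≈0 = CoeffΦ-vanishes (canonical f) (length x) (dropClass f x) (LP.length-filter _ x) cx′ others

      injective : IsZeroN x
      injective f f! = ClassZero-all (suc (totalLength x)) f f! (ℕP.m≤n+m (suc (totalLength x)) (length f))

mainTheorem9 : (r s : ℕ) {c ℓ : Level} (K : CommutativeRing c ℓ) → IsFieldChar0 K →
    let open Sig r s
        open Lin K
    in ((x : Combo) → ReducedCombo x → IsZeroΦ x → IsZeroN x)
       × ((f g : Forest) → Reduced f → Reduced g → (u : Word) (n m : ℕ) →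
          ClassCoeff (f ++ g) u n → SplitSum f g (splits u) m → n ≡ m)
mainTheorem9 r s K K-field =
  Injectivity.injective K K-field ,
  λ f g _ _ u _ _ → ClassCoeff-++-splits f g u
  where open Forests r s
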